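{- Let $\lambda$ be a nonzero real number. For every integer $n\ge 0$, \[ B_n(x)=\sum_{m=0}^n\sum_{k=m}^n\lambda^{k-m}S_2(k,m)\binom{n}{k}B_{n-k}\,b_{m,\lambda}(x)\;-\;n\sum_{m=0}^{n-1}\lambda^{n-m-1}S_2(n-1,m)\,b_{m,\lambda}(x). \]
   Context: For a nonzero real $\lambda$, the degenerate ordered Bell polynomials $b_{n,\lambda}(x)$ are defined by the formal power series identity \[ \frac{1}{2-(1+\lambda t)^{1/\lambda}}(1+\lambda t)^{x/\lambda}=\sum_{n=0}^\infty b_{n,\lambda}(x)\frac{t^n}{n!}, \] where $(1+\lambda t)^{a/\lambda}=\exp\big(\tfrac{a}{\lambda}\log(1+\lambda t)\big)$. The Bernoulli polynomials $B_n(x)$ are defined by $\frac{t}{e^t-1}e^{xt}=\sum_{n\ge 0}B_n(x)\frac{t^n}{n!}$ and $B_n=B_n(0)$. The Stirling numbers of the second kind $S_2(n,l)$ are defined by $x^n=\sum_{l=0}^n S_2(n,l)\,x(x-1)\cdots(x-l+1)$. For $n=0$ the second sum is empty. -}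

module Defs where

open import Level using (Level)
open import Data.Nat as ℕ using (ℕ; zero; suc; _∸_; _≤?_)
open import Data.Nat.Combinatorics using (_C_)
open import Relation.Nullary using (yes; no)
open import Algebra.Bundles using (CommutativeRing; Semiring)

-- Stirling numbers of the second kind S₂(n,l), via the standard recursion
-- S₂(0,0)=1, S₂(n+1,0)=0, S₂(0,l+1)=0, S₂(n+1,l+1)=S₂(n,l)+(l+1)S₂(n,l+1),
-- which are the unique coefficients with x^n = Σ_l S₂(n,l) x(x-1)…(x-l+1).
S₂ : ℕ → ℕ → ℕ
S₂ zero    zero    = 1
S₂ zero    (suc l) = 0
S₂ (suc n) zero    = 0
S₂ (suc n) (suc l) = S₂ n l ℕ.+ suc l ℕ.* S₂ n (suc l)

-- All constructions below take place in a commutative ring R in which every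
-- positive integer n+1 has the inverse inv n (hypothesis stated in Statement).
module Q {c ℓ : Level} (R : CommutativeRing c ℓ) (inv : ℕ → CommutativeRing.Carrier R) where
  open CommutativeRing R
  open import Algebra.Definitions.RawSemiring (Semiring.rawSemiring semiring) using (_×_; _^_)

  sumLt : ℕ → (ℕ → Carrier) → Carrier
  sumLt zero    f = 0#
  sumLt (suc n) f = sumLt n f + f n

  prodLt : ℕ → (ℕ → Carrier) → Carrier
  prodLt zero    f = 1#
  prodLt (suc n) f = prodLt n f * f n

  ⟦_⟧ : ℕ → Carrier
  ⟦ n ⟧ = n × 1#

  -- degenerate falling factorial (x)_{n,λ} = x(x-λ)⋯(x-(n-1)λ);
  -- (1+λt)^{x/λ} = Σ_n (x)_{n,λ} tⁿ/n!
  dfall : Carrier → Carrier → ℕ → Carrier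
  dfall lam x n = prodLt n (λ i → x - (i × lam))

  -- EGF coefficients f_n of 1/(2-(1+λt)^{1/λ}) = Σ f_n tⁿ/n!,
  -- i.e. the unique sequence with (2-(1+λt)^{1/λ}) · Σ f_n tⁿ/n! = 1:
  -- f₀ = 1,  f_N = Σ_{k=1}^{N} C(N,k) (1)_{k,λ} f_{N-k}.
  -- fTable n m = f_m for m ≤ n.
  fTable : Carrier → ℕ → ℕ → Carrier
  fTable lam zero    m = 1#
  fTable lam (suc n) m with m ≤? n
  ... | yes _ = fTable lam n m
  ... | no  _ = sumLt (suc n) (λ j → ⟦ suc n C suc j ⟧ * (dfall lam 1# (suc j) * fTable lam n (n ∸ j)))

  fCoeff : Carrier → ℕ → Carrier
  fCoeff lam n = fTable lam n n

  -- degenerate ordered Bell polynomial b_{n,λ}(x): EGF coefficients of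
  -- (Σ f_k t^k/k!) · (Σ (x)_{j,λ} t^j/j!)
  b : Carrier → ℕ → Carrier → Carrier
  b lam n x = sumLt (suc n) (λ k → ⟦ n C k ⟧ * (fCoeff lam k * dfall lam x (n ∸ k)))

  -- Bernoulli numbers: EGF coefficients of t/(eᵗ-1), i.e. the unique sequence with
  -- (Σ tⁿ/(n+1)!) · (Σ B_n tⁿ/n!) = 1:  B₀ = 1, B_N = -(1/(N+1)) Σ_{k<N} C(N+1,k) B_k.
  -- BTable n m = B_m for m ≤ n.
  BTable : ℕ → ℕ → Carrier
  BTable zero    m = 1#
  BTable (suc n) m with m ≤? n
  ... | yes _ = BTable n m
  ... | no  _ = - (inv (suc n) * sumLt (suc n) (λ k → ⟦ suc (suc n) C k ⟧ * BTable n k))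

  Bern : ℕ → Carrier
  Bern n = BTable n n

  BernPoly : ℕ → Carrier → Carrier
  BernPoly n x = sumLt (suc n) (λ k → ⟦ n C k ⟧ * (Bern k * (x ^ (n ∸ k))))

  rhs : Carrier → ℕ → Carrier → Carrier
  rhs lam n x =
    sumLt (suc n) (λ m →
      sumLt (suc n ∸ m) (λ j →
        (lam ^ j) * (⟦ S₂ (m ℕ.+ j) m ⟧ * (⟦ n C (m ℕ.+ j) ⟧ * (Bern (n ∸ (m ℕ.+ j)) * b lam m x)))))
    - (n × sumLt n (λ m → (lam ^ (n ∸ m ∸ 1)) * (⟦ S₂ (n ∸ 1) m ⟧ * b lam m x)))

module Submission where

-- Theorem 9 is an identity between exponential generating functions, proved
-- here on coefficient sequences ℕ → R over a commutative ring R in which the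
-- positive integers are invertible.
--
-- Sequences form a ring under pointwise addition and the binomial convolution
-- (a ⊛ d)ₙ = Σₖ C(n,k) aₖ d_{n-k}, the product of EGFs.  Its laws follow from
-- the Leibniz rule for the shift ∂ (the derivative d/dt).  The Stirling
-- transform (Φ a)ₖ = Σₘ λ^{k-m} S₂(k,m) aₘ is the substitution
-- t ↦ (e^{λt}-1)/λ: it intertwines ∂ with (1+λt)d/dt, is therefore a
-- ⊛-homomorphism, and maps the degenerate falling factorials (y)_{m,λ}
-- (EGF (1+λt)^{y/λ}) to the powers yᵏ (EGF e^{yt}).
--
-- Main argument: the recursion defining the ordered Bell coefficients f says
-- (2 − (1+λt)^{1/λ}) f = 1; hence b = f·(1+λt)^{x/λ} satisfies
-- (1+λt)^{1/λ} b + (1+λt)^{x/λ} = 2b.  Applying Φ gives eᵗ g + e^{xt} = 2g for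
-- g = Φ b.  The Bernoulli recursion says B eᵗ = B + t, so multiplying by B
-- yields B e^{xt} = B g − t g.  The left side is Bₙ(x); expanding B g and t g
-- gives the two sums of the theorem.

open import Defs
open import Level using (Level)
open import Data.Nat as ℕ using (ℕ; zero; suc; _∸_; _≤_; _<_; s≤s; _≤?_)
import Data.Nat.Properties as ℕₚ
open import Data.Nat.Combinatorics
  using (_C_; nCk+nC[k+1]≡[n+1]C[k+1]; k>n⇒nCk≡0; nCn≡1; nCk≡nC[n∸k]; nC1≡n)
open import Data.Maybe using (nothing)
open import Data.Empty using (⊥-elim)
open import Relation.Nullary using (¬_; yes; no)
import Relation.Binary.PropositionalEquality as P
open P using (_≡_)
open import Algebra.Bundles using (CommutativeRing; Semiring)
import Algebra.Construct.Pointwise as Pointwise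
import Algebra.Properties.Group as GroupProperties
import Relation.Binary.Reasoning.Setoid as SetoidReasoning

table-diagonal : ∀ {a} {A : Set a} (t : ℕ → ℕ → A) →
                 (∀ n m → m ≤ n → t (suc n) m ≡ t n m) →
                 ∀ n m → m ≤ n → t n m ≡ t m m
table-diagonal t extends n m m≤n =
  P.subst (λ k → t k m ≡ t m m) (ℕₚ.m∸n+n≡m m≤n) (above (n ∸ m))
  where
  above : ∀ d → t (d ℕ.+ m) m ≡ t m m
  above zero    = P.refl
  above (suc d) = P.trans (extends (d ℕ.+ m) m (ℕₚ.m≤n+m m d)) (above d)

S₂-vanishes : ∀ k m → k < m → S₂ k m ≡ 0
S₂-vanishes zero    (suc m) _         = P.refl
S₂-vanishes (suc k) (suc m) (s≤s k<m) =
  P.trans (P.cong₂ (λ u v → u ℕ.+ suc m ℕ.* v)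
                   (S₂-vanishes k m k<m) (S₂-vanishes k (suc m) (ℕₚ.m<n⇒m<1+n k<m)))
          (ℕₚ.*-zeroʳ (suc m))

[1+n]Cn≡1+n : ∀ n → suc n C n ≡ suc n
[1+n]Cn≡1+n n =
  P.trans (nCk≡nC[n∸k] {k = n} {n = suc n} (ℕₚ.n≤1+n n))
          (P.trans (P.cong (suc n C_) (ℕₚ.m+n∸n≡m 1 n)) (nC1≡n (suc n)))

module Sequences {c ℓ : Level} (R : CommutativeRing c ℓ) (inv : ℕ → CommutativeRing.Carrier R) where
  open CommutativeRing R
  open Q R inv
  open import Algebra.Definitions.RawSemiring (Semiring.rawSemiring semiring) using (_×_; _^_)
  open import Algebra.Properties.Semiring.Mult semiring using (×-homo-+; ×1-homo-*; ×-assoc-*; ×-congʳ)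
  open import Algebra.Properties.Ring ring using (-‿distribʳ-*)
  open import Algebra.Solver.Ring.NaturalCoefficients commutativeSemiring (λ _ _ → nothing)
    using (solve; _:+_; _:*_; _:=_)
  open SetoidReasoning setoid

  sum-cong : ∀ n {f g : ℕ → Carrier} → (∀ i → i < n → f i ≈ g i) → sumLt n f ≈ sumLt n g
  sum-cong zero    f≈g = refl
  sum-cong (suc n) f≈g = +-cong (sum-cong n (λ i i<n → f≈g i (ℕₚ.m<n⇒m<1+n i<n))) (f≈g n ℕₚ.≤-refl)

  sum-cong′ : ∀ n {f g : ℕ → Carrier} → (∀ i → f i ≈ g i) → sumLt n f ≈ sumLt n g
  sum-cong′ n f≈g = sum-cong n (λ i _ → f≈g i)

  sum-+ : ∀ n (f g : ℕ → Carrier) → sumLt n (λ i → f i + g i) ≈ sumLt n f + sumLt n g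
  sum-+ zero    f g = sym (+-identityˡ 0#)
  sum-+ (suc n) f g = begin
    sumLt n (λ i → f i + g i) + (f n + g n) ≈⟨ +-congʳ (sum-+ n f g) ⟩
    (sumLt n f + sumLt n g) + (f n + g n)   ≈⟨ solve 4 (λ a b d e → (a :+ b) :+ (d :+ e) := (a :+ d) :+ (b :+ e))
                                                      refl (sumLt n f) (sumLt n g) (f n) (g n) ⟩
    (sumLt n f + f n) + (sumLt n g + g n)   ∎

  sum-*ˡ : ∀ n r (f : ℕ → Carrier) → sumLt n (λ i → r * f i) ≈ r * sumLt n f
  sum-*ˡ zero    r f = sym (zeroʳ r)
  sum-*ˡ (suc n) r f = trans (+-congʳ (sum-*ˡ n r f)) (sym (distribˡ r (sumLt n f) (f n)))

  sum-zero : ∀ n (f : ℕ → Carrier) → (∀ i → f i ≈ 0#) → sumLt n f ≈ 0#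
  sum-zero zero    f f≈0 = refl
  sum-zero (suc n) f f≈0 = trans (+-cong (sum-zero n f f≈0) (f≈0 n)) (+-identityˡ 0#)

  sum-first : ∀ n (f : ℕ → Carrier) → sumLt (suc n) f ≈ f 0 + sumLt n (λ i → f (suc i))
  sum-first zero    f = trans (+-identityˡ (f 0)) (sym (+-identityʳ (f 0)))
  sum-first (suc n) f = trans (+-congʳ (sum-first n f)) (+-assoc _ _ _)

  sum-interchange : ∀ n (F : ℕ → ℕ → Carrier) →
    sumLt n (λ k → sumLt (suc k) (F k)) ≈ sumLt n (λ m → sumLt (n ∸ m) (λ j → F (m ℕ.+ j) m))
  sum-interchange zero    F = refl
  sum-interchange (suc n) F = begin
    sumLt n (λ k → sumLt (suc k) (F k)) + (sumLt n (F n) + F n n) ≈⟨ +-congʳ (sum-interchange n F) ⟩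
    rows n + (sumLt n (F n) + F n n)                                ≈⟨ sym (+-assoc _ _ _) ⟩
    (rows n + sumLt n (F n)) + F n n                                ≈⟨ sym (+-cong (trans (sum-cong n longer-row) (sum-+ n _ _)) last-row) ⟩
    rows (suc n) + sumLt (suc n ∸ n) (λ j → F (n ℕ.+ j) n)          ∎
    where
    rows : ℕ → Carrier
    rows l = sumLt n (λ m → sumLt (l ∸ m) (λ j → F (m ℕ.+ j) m))
    longer-row : ∀ m → m < n → sumLt (suc n ∸ m) (λ j → F (m ℕ.+ j) m) ≈ sumLt (n ∸ m) (λ j → F (m ℕ.+ j) m) + F n m
    longer-row m m<n =
      trans (reflexive (P.cong (λ l → sumLt l (λ j → F (m ℕ.+ j) m)) (ℕₚ.+-∸-assoc 1 (ℕₚ.<⇒≤ m<n))))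
            (+-congˡ (reflexive (P.cong (λ k → F k m) (ℕₚ.m+[n∸m]≡n (ℕₚ.<⇒≤ m<n)))))
    last-row : sumLt (suc n ∸ n) (λ j → F (n ℕ.+ j) n) ≈ F n n
    last-row = trans (reflexive (P.cong (λ l → sumLt l (λ j → F (n ℕ.+ j) n)) (ℕₚ.m+n∸n≡m 1 n)))
                     (trans (+-identityˡ _) (reflexive (P.cong (λ k → F k n) (ℕₚ.+-identityʳ n))))

  ⟦+⟧ : ∀ m n → ⟦ m ℕ.+ n ⟧ ≈ ⟦ m ⟧ + ⟦ n ⟧
  ⟦+⟧ m n = ×-homo-+ 1# m n

  ⟦1⟧ : ⟦ 1 ⟧ ≈ 1#
  ⟦1⟧ = +-identityʳ 1#

  ⟦1⟧* : ∀ y → ⟦ 1 ⟧ * y ≈ y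
  ⟦1⟧* y = trans (*-congʳ ⟦1⟧) (*-identityˡ y)

  ×≈⟦⟧* : ∀ n y → n × y ≈ ⟦ n ⟧ * y
  ×≈⟦⟧* n y = sym (trans (×-assoc-* n 1# y) (×-congʳ n (*-identityˡ y)))

  Seq : Set c
  Seq = ℕ → Carrier

  open CommutativeRing (Pointwise.commutativeRing ℕ R) public
    using () renaming (_≈_ to _≋_; _+_ to _⊕_; _-_ to _⊖_)

  -- Scalar multiplication and the distinguished sequences, named by their EGF:
  -- δ = 1, T = t, E = eᵗ, pow y = e^{yt}.
  _·_ : Carrier → Seq → Seq
  (r · a) j = r * a j

  δ T E : Seq
  δ zero    = 1#
  δ (suc _) = 0#
  T zero    = 0#
  T (suc j) = δ j
  E _       = 1#

  pow : Carrier → Seq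
  pow y k = y ^ k

  pow-1# : pow 1# ≋ E
  pow-1# zero    = refl
  pow-1# (suc k) = trans (*-identityˡ _) (pow-1# k)

  -- The shift ∂ (derivative d/dt) and the Euler operator θ (t d/dt).
  ∂ θ : Seq → Seq
  ∂ a j = a (suc j)
  θ a j = ⟦ j ⟧ * a j

  infixl 7 _⊛_
  _⊛_ : Seq → Seq → Seq
  (a ⊛ d) n = sumLt (suc n) (λ k → ⟦ n C k ⟧ * (a k * d (n ∸ k)))

  ⊛-congʳ : ∀ {a a′} d → a ≋ a′ → a ⊛ d ≋ a′ ⊛ d
  ⊛-congʳ d a≋a′ n = sum-cong′ (suc n) (λ k → *-congˡ (*-congʳ (a≋a′ k)))

  ⊛-congˡ : ∀ a {d d′} → d ≋ d′ → a ⊛ d ≋ a ⊛ d′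
  ⊛-congˡ a d≋d′ n = sum-cong′ (suc n) (λ k → *-congˡ (*-congˡ (d≋d′ (n ∸ k))))

  ⊛-at-0 : ∀ a d → (a ⊛ d) 0 ≈ a 0 * d 0
  ⊛-at-0 a d = trans (+-identityˡ _) (⟦1⟧* _)

  ⊛-distribʳ : ∀ a a′ d → (a ⊕ a′) ⊛ d ≋ a ⊛ d ⊕ a′ ⊛ d
  ⊛-distribʳ a a′ d n =
    trans (sum-cong′ (suc n) (λ k → trans (*-congˡ (distribʳ _ _ _)) (distribˡ _ _ _))) (sum-+ (suc n) _ _)

  ⊛-distribˡ : ∀ a d d′ → a ⊛ (d ⊕ d′) ≋ a ⊛ d ⊕ a ⊛ d′
  ⊛-distribˡ a d d′ n =
    trans (sum-cong′ (suc n) (λ k → trans (*-congˡ (distribˡ _ _ _)) (distribˡ _ _ _))) (sum-+ (suc n) _ _)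

  ⊛-scalarˡ : ∀ r a d → (r · a) ⊛ d ≋ r · (a ⊛ d)
  ⊛-scalarˡ r a d n = trans
    (sum-cong′ (suc n) (λ k → solve 4 (λ C r a d → C :* ((r :* a) :* d) := r :* (C :* (a :* d))) refl _ r _ _))
    (sum-*ˡ (suc n) r _)

  ⊛-scalarʳ : ∀ r a d → a ⊛ (r · d) ≋ r · (a ⊛ d)
  ⊛-scalarʳ r a d n = trans
    (sum-cong′ (suc n) (λ k → solve 4 (λ C r a d → C :* (a :* (r :* d)) := r :* (C :* (a :* d))) refl _ r _ _))
    (sum-*ˡ (suc n) r _)

  ⊛-zeroˡ : ∀ d → (λ _ → 0#) ⊛ d ≋ (λ _ → 0#)
  ⊛-zeroˡ d n = sum-zero (suc n) _ (λ k → trans (*-congˡ (zeroˡ _)) (zeroʳ _))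

  -- Leibniz rule: ∂ is a derivation of ⊛.  This is Pascal's rule for C(n+1,k+1).
  ∂-⊛ : ∀ a d → ∂ (a ⊛ d) ≋ ∂ a ⊛ d ⊕ a ⊛ ∂ d
  ∂-⊛ a d n = begin
    (a ⊛ d) (suc n)                                                ≈⟨ sum-first (suc n) _ ⟩
    first + sumLt (suc n) (λ k → ⟦ suc n C suc k ⟧ * (a (suc k) * d (n ∸ k)))
      ≈⟨ +-congˡ (trans (sum-cong′ (suc n) pascal) (sum-+ (suc n) _ _)) ⟩
    first + ((∂ a ⊛ d) n + sumLt (suc n) rest)                     ≈⟨ +-congˡ (+-congˡ (trans (+-congˡ rest-vanishes) (+-identityʳ _))) ⟩
    first + ((∂ a ⊛ d) n + sumLt n rest)                           ≈⟨ solve 3 (λ x y z → x :+ (y :+ z) := y :+ (x :+ z)) refl first _ _ ⟩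
    (∂ a ⊛ d) n + (first + sumLt n rest)
      ≈⟨ +-congˡ (+-congˡ (sum-cong n (λ k k<n → *-congˡ (*-congˡ (reflexive (P.cong d (ℕₚ.+-∸-assoc 1 k<n))))))) ⟩
    (∂ a ⊛ d) n + (first + sumLt n (λ k → ⟦ n C suc k ⟧ * (a (suc k) * ∂ d (n ∸ suc k))))
      ≈⟨ +-congˡ (sym (sum-first n _)) ⟩
    (∂ a ⊛ d) n + (a ⊛ ∂ d) n                                      ∎
    where
    first : Carrier
    first = ⟦ 1 ⟧ * (a 0 * d (suc n))
    rest : ℕ → Carrier
    rest k = ⟦ n C suc k ⟧ * (a (suc k) * d (n ∸ k))
    pascal : ∀ k → ⟦ suc n C suc k ⟧ * (a (suc k) * d (n ∸ k)) ≈ ⟦ n C k ⟧ * (a (suc k) * d (n ∸ k)) + rest k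
    pascal k = trans (*-congʳ (trans (reflexive (P.cong ⟦_⟧ (P.sym (nCk+nC[k+1]≡[n+1]C[k+1] n k))))
                                     (⟦+⟧ (n C k) (n C suc k))))
                     (distribʳ _ _ _)
    rest-vanishes : rest n ≈ 0#
    rest-vanishes = trans (*-congʳ (reflexive (P.cong ⟦_⟧ (k>n⇒nCk≡0 (ℕₚ.n<1+n n))))) (zeroˡ _)

  -- θ is a derivation of ⊛, because n = k + (n - k).
  θ-⊛ : ∀ a d → θ (a ⊛ d) ≋ θ a ⊛ d ⊕ a ⊛ θ d
  θ-⊛ a d n = trans (sym (sum-*ˡ (suc n) _ _)) (trans (sum-cong (suc n) split) (sum-+ (suc n) _ _))
    where
    split : ∀ k → k < suc n → ⟦ n ⟧ * (⟦ n C k ⟧ * (a k * d (n ∸ k)))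
                              ≈ ⟦ n C k ⟧ * (θ a k * d (n ∸ k)) + ⟦ n C k ⟧ * (a k * θ d (n ∸ k))
    split k (s≤s k≤n) =
      trans (*-congʳ (trans (reflexive (P.cong ⟦_⟧ (P.sym (ℕₚ.m+[n∸m]≡n k≤n)))) (⟦+⟧ k (n ∸ k))))
            (solve 5 (λ K D C A E → (K :+ D) :* (C :* (A :* E)) := C :* ((K :* A) :* E) :+ C :* (A :* (D :* E)))
                   refl _ _ _ _ _)

  ⊛-comm : ∀ a d → a ⊛ d ≋ d ⊛ a
  ⊛-comm a d zero    = trans (⊛-at-0 a d) (trans (*-comm _ _) (sym (⊛-at-0 d a)))
  ⊛-comm a d (suc n) = begin
    (a ⊛ d) (suc n)                 ≈⟨ ∂-⊛ a d n ⟩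
    (∂ a ⊛ d) n + (a ⊛ ∂ d) n       ≈⟨ +-cong (⊛-comm (∂ a) d n) (⊛-comm a (∂ d) n) ⟩
    (d ⊛ ∂ a) n + (∂ d ⊛ a) n       ≈⟨ +-comm _ _ ⟩
    (∂ d ⊛ a) n + (d ⊛ ∂ a) n       ≈⟨ sym (∂-⊛ d a n) ⟩
    (d ⊛ a) (suc n)                 ∎

  ⊛-assoc : ∀ a d e → (a ⊛ d) ⊛ e ≋ a ⊛ (d ⊛ e)
  ⊛-assoc a d e zero = begin
    ((a ⊛ d) ⊛ e) 0   ≈⟨ trans (⊛-at-0 (a ⊛ d) e) (*-congʳ (⊛-at-0 a d)) ⟩
    (a 0 * d 0) * e 0 ≈⟨ *-assoc _ _ _ ⟩
    a 0 * (d 0 * e 0) ≈⟨ sym (trans (⊛-at-0 a (d ⊛ e)) (*-congˡ (⊛-at-0 d e))) ⟩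
    (a ⊛ (d ⊛ e)) 0   ∎
  ⊛-assoc a d e (suc n) = begin
    ((a ⊛ d) ⊛ e) (suc n)
      ≈⟨ ∂-⊛ (a ⊛ d) e n ⟩
    (∂ (a ⊛ d) ⊛ e) n + ((a ⊛ d) ⊛ ∂ e) n
      ≈⟨ +-congʳ (trans (⊛-congʳ e (∂-⊛ a d) n) (⊛-distribʳ (∂ a ⊛ d) (a ⊛ ∂ d) e n)) ⟩
    ((∂ a ⊛ d) ⊛ e) n + ((a ⊛ ∂ d) ⊛ e) n + ((a ⊛ d) ⊛ ∂ e) n
      ≈⟨ +-cong (+-cong (⊛-assoc (∂ a) d e n) (⊛-assoc a (∂ d) e n)) (⊛-assoc a d (∂ e) n) ⟩
    (∂ a ⊛ (d ⊛ e)) n + (a ⊛ (∂ d ⊛ e)) n + (a ⊛ (d ⊛ ∂ e)) n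
      ≈⟨ +-assoc _ _ _ ⟩
    (∂ a ⊛ (d ⊛ e)) n + ((a ⊛ (∂ d ⊛ e)) n + (a ⊛ (d ⊛ ∂ e)) n)
      ≈⟨ +-congˡ (sym (trans (⊛-congˡ a (∂-⊛ d e) n) (⊛-distribˡ a (∂ d ⊛ e) (d ⊛ ∂ e) n))) ⟩
    (∂ a ⊛ (d ⊛ e)) n + (a ⊛ ∂ (d ⊛ e)) n
      ≈⟨ sym (∂-⊛ a (d ⊛ e) n) ⟩
    (a ⊛ (d ⊛ e)) (suc n) ∎

  ⊛-identityˡ : ∀ u → δ ⊛ u ≋ u
  ⊛-identityˡ u zero    = trans (⊛-at-0 δ u) (*-identityˡ _)
  ⊛-identityˡ u (suc n) = begin
    (δ ⊛ u) (suc n)               ≈⟨ ∂-⊛ δ u n ⟩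
    (∂ δ ⊛ u) n + (δ ⊛ ∂ u) n     ≈⟨ +-cong (⊛-zeroˡ u n) (⊛-identityˡ (∂ u) n) ⟩
    0# + u (suc n)                ≈⟨ +-identityˡ _ ⟩
    u (suc n)                     ∎

  T⊛-at-0 : ∀ h → (T ⊛ h) 0 ≈ 0#
  T⊛-at-0 h = trans (⊛-at-0 T h) (zeroˡ _)

  T⊛-at-suc : ∀ n h → (T ⊛ h) (suc n) ≈ ⟦ suc n ⟧ * h n
  T⊛-at-suc n h = begin
    (T ⊛ h) (suc n)               ≈⟨ ∂-⊛ T h n ⟩
    (δ ⊛ h) n + (T ⊛ ∂ h) n       ≈⟨ +-congʳ (⊛-identityˡ h n) ⟩
    h n + (T ⊛ ∂ h) n             ≈⟨ +-congˡ (shifted n) ⟩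
    h n + ⟦ n ⟧ * h n             ≈⟨ sym (trans (distribʳ _ _ _) (+-congʳ (*-identityˡ _))) ⟩
    ⟦ suc n ⟧ * h n               ∎
    where
    shifted : ∀ n → (T ⊛ ∂ h) n ≈ ⟦ n ⟧ * h n
    shifted zero    = trans (T⊛-at-0 (∂ h)) (sym (zeroˡ _))
    shifted (suc n) = T⊛-at-suc n (∂ h)

  module Stirling (lam : Carrier) where

    Φ : Seq → Seq
    Φ a k = sumLt (suc k) (λ m → lam ^ (k ∸ m) * (⟦ S₂ k m ⟧ * a m))

    -- ∂λ = ∂ + λθ is the operator (1+λt) d/dt.
    ∂λ : Seq → Seq
    ∂λ a = ∂ a ⊕ lam · θ a

    ∂λ-⊛ : ∀ a d → ∂λ (a ⊛ d) ≋ ∂λ a ⊛ d ⊕ a ⊛ ∂λ d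
    ∂λ-⊛ a d m = begin
      (a ⊛ d) (suc m) + lam * θ (a ⊛ d) m
        ≈⟨ +-cong (∂-⊛ a d m) (*-congˡ (θ-⊛ a d m)) ⟩
      ((∂ a ⊛ d) m + (a ⊛ ∂ d) m) + lam * ((θ a ⊛ d) m + (a ⊛ θ d) m)
        ≈⟨ solve 5 (λ p q l r s → (p :+ q) :+ l :* (r :+ s) := (p :+ l :* r) :+ (q :+ l :* s)) refl _ _ lam _ _ ⟩
      ((∂ a ⊛ d) m + lam * (θ a ⊛ d) m) + ((a ⊛ ∂ d) m + lam * (a ⊛ θ d) m)
        ≈⟨ sym (+-cong (trans (⊛-distribʳ (∂ a) (lam · θ a) d m) (+-congˡ (⊛-scalarˡ lam (θ a) d m)))
                       (trans (⊛-distribˡ a (∂ d) (lam · θ d) m) (+-congˡ (⊛-scalarʳ lam a (θ d) m)))) ⟩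
      (∂λ a ⊛ d) m + (a ⊛ ∂λ d) m ∎

    Φ-cong : ∀ {a a′} → a ≋ a′ → Φ a ≋ Φ a′
    Φ-cong a≋a′ k = sum-cong′ (suc k) (λ m → *-congˡ (*-congˡ (a≋a′ m)))

    Φ-⊕ : ∀ a d → Φ (a ⊕ d) ≋ Φ a ⊕ Φ d
    Φ-⊕ a d k = trans (sum-cong′ (suc k) (λ m → trans (*-congˡ (distribˡ _ _ _)) (distribˡ _ _ _))) (sum-+ (suc k) _ _)

    Φ-· : ∀ r a → Φ (r · a) ≋ r · Φ a
    Φ-· r a k = trans
      (sum-cong′ (suc k) (λ m → solve 4 (λ p s r x → p :* (s :* (r :* x)) := r :* (p :* (s :* x))) refl _ _ r _))
      (sum-*ˡ (suc k) r _)

    Φ-at-0 : ∀ a → Φ a 0 ≈ a 0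
    Φ-at-0 a = trans (+-identityˡ _) (trans (*-identityˡ _) (⟦1⟧* _))

    -- Chain rule: d/ds of a(t(s)) is ((1+λt) d/dt a)(t(s)).  On coefficients
    -- this is the Stirling recursion S₂(k+1,m+1) = S₂(k,m) + (m+1) S₂(k,m+1).
    ∂-Φ : ∀ a → ∂ (Φ a) ≋ Φ (∂λ a)
    ∂-Φ a k = begin
      Φ a (suc k)                                ≈⟨ sum-first (suc k) _ ⟩
      term₀ + sumLt (suc k) (λ m → lam ^ (k ∸ m) * (⟦ S₂ (suc k) (suc m) ⟧ * a (suc m)))
        ≈⟨ +-cong term₀≈0 (trans (sum-cong′ (suc k) stirling) (sum-+ (suc k) u v)) ⟩
      0# + (sumLt (suc k) u + sumLt (suc k) v)   ≈⟨ +-identityˡ _ ⟩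
      sumLt (suc k) u + sumLt (suc k) v          ≈⟨ +-congˡ (trans (+-congˡ v-last) (+-identityʳ _)) ⟩
      sumLt (suc k) u + sumLt k v                ≈⟨ +-congˡ (sum-cong k v≈w) ⟩
      sumLt (suc k) u + sumLt k (λ m → w (suc m)) ≈⟨ +-congˡ (sym (trans (sum-first k w) (trans (+-congʳ w-first) (+-identityˡ _)))) ⟩
      sumLt (suc k) u + sumLt (suc k) w          ≈⟨ sym (trans (sum-cong′ (suc k) (λ m → trans (*-congˡ (distribˡ _ _ _)) (distribˡ _ _ _)))
                                                               (sum-+ (suc k) u w)) ⟩
      Φ (∂λ a) k                                 ∎
      where
      term₀ : Carrier
      term₀ = lam ^ (suc k) * (⟦ 0 ⟧ * a 0)
      term₀≈0 : term₀ ≈ 0#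
      term₀≈0 = trans (*-congˡ (zeroˡ _)) (zeroʳ _)
      u v w : ℕ → Carrier
      u m = lam ^ (k ∸ m) * (⟦ S₂ k m ⟧ * a (suc m))
      v m = lam ^ (k ∸ m) * (⟦ suc m ⟧ * (⟦ S₂ k (suc m) ⟧ * a (suc m)))
      w m = lam ^ (k ∸ m) * (⟦ S₂ k m ⟧ * (lam * (⟦ m ⟧ * a m)))
      stirling : ∀ m → lam ^ (k ∸ m) * (⟦ S₂ (suc k) (suc m) ⟧ * a (suc m)) ≈ u m + v m
      stirling m =
        trans (*-congˡ (*-congʳ (trans (⟦+⟧ (S₂ k m) (suc m ℕ.* S₂ k (suc m))) (+-congˡ (×1-homo-* (suc m) (S₂ k (suc m)))))))
              (solve 5 (λ p s m1 s′ x → p :* ((s :+ m1 :* s′) :* x) := p :* (s :* x) :+ p :* (m1 :* (s′ :* x)))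
                     refl _ _ _ _ _)
      v-last : v k ≈ 0#
      v-last = trans (*-congˡ (trans (*-congˡ (trans (*-congʳ (reflexive (P.cong ⟦_⟧ (S₂-vanishes k (suc k) (ℕₚ.n<1+n k)))))
                                                     (zeroˡ _)))
                                     (zeroʳ _)))
                     (zeroʳ _)
      w-first : w 0 ≈ 0#
      w-first = trans (*-congˡ (trans (*-congˡ (trans (*-congˡ (zeroˡ _)) (zeroʳ _))) (zeroʳ _))) (zeroʳ _)
      v≈w : ∀ m → m < k → v m ≈ w (suc m)
      v≈w m m<k = trans (*-congʳ (reflexive (P.cong (lam ^_) (ℕₚ.+-∸-assoc 1 m<k))))
                        (solve 5 (λ p l m1 s x → (l :* p) :* (m1 :* (s :* x)) := p :* (s :* (l :* (m1 :* x))))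
                               refl _ lam _ _ _)

    -- Φ is multiplicative: both sides agree at 0 and ∂ acts on both as a derivation.
    Φ-⊛ : ∀ a d → Φ (a ⊛ d) ≋ Φ a ⊛ Φ d
    Φ-⊛ a d zero = trans (Φ-at-0 (a ⊛ d)) (trans (⊛-at-0 a d)
                     (sym (trans (⊛-at-0 (Φ a) (Φ d)) (*-cong (Φ-at-0 a) (Φ-at-0 d)))))
    Φ-⊛ a d (suc k) = begin
      Φ (a ⊛ d) (suc k)                               ≈⟨ ∂-Φ (a ⊛ d) k ⟩
      Φ (∂λ (a ⊛ d)) k                                ≈⟨ Φ-cong (∂λ-⊛ a d) k ⟩
      Φ (∂λ a ⊛ d ⊕ a ⊛ ∂λ d) k                       ≈⟨ Φ-⊕ (∂λ a ⊛ d) (a ⊛ ∂λ d) k ⟩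
      Φ (∂λ a ⊛ d) k + Φ (a ⊛ ∂λ d) k                 ≈⟨ +-cong (Φ-⊛ (∂λ a) d k) (Φ-⊛ a (∂λ d) k) ⟩
      (Φ (∂λ a) ⊛ Φ d) k + (Φ a ⊛ Φ (∂λ d)) k
        ≈⟨ sym (+-cong (⊛-congʳ (Φ d) (∂-Φ a) k) (⊛-congˡ (Φ a) (∂-Φ d) k)) ⟩
      (∂ (Φ a) ⊛ Φ d) k + (Φ a ⊛ ∂ (Φ d)) k           ≈⟨ sym (∂-⊛ (Φ a) (Φ d) k) ⟩
      (Φ a ⊛ Φ d) (suc k)                             ∎

    ∂λ-dfall : ∀ y → ∂λ (dfall lam y) ≋ y · dfall lam y
    ∂λ-dfall y m = begin
      D m * (y - m × lam) + lam * (⟦ m ⟧ * D m)        ≈⟨ +-congʳ (*-congˡ (+-congˡ (-‿cong (×≈⟦⟧* m lam)))) ⟩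
      D m * (y + - (⟦ m ⟧ * lam)) + lam * (⟦ m ⟧ * D m) ≈⟨ +-congʳ (trans (distribˡ _ _ _) (+-congˡ (sym (-‿distribʳ-* _ _)))) ⟩
      (D m * y + - Z) + lam * (⟦ m ⟧ * D m)            ≈⟨ +-congˡ (solve 3 (λ l k d → l :* (k :* d) := d :* (k :* l)) refl lam _ _) ⟩
      (D m * y + - Z) + Z                              ≈⟨ +-assoc _ _ _ ⟩
      D m * y + (- Z + Z)                              ≈⟨ +-congˡ (-‿inverseˡ Z) ⟩
      D m * y + 0#                                     ≈⟨ +-identityʳ _ ⟩
      D m * y                                          ≈⟨ *-comm _ _ ⟩
      y * D m                                          ∎
      where
      D : Seq
      D = dfall lam y
      Z : Carrier
      Z = D m * (⟦ m ⟧ * lam)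

    Φ-dfall : ∀ y → Φ (dfall lam y) ≋ pow y
    Φ-dfall y zero    = Φ-at-0 (dfall lam y)
    Φ-dfall y (suc k) = begin
      Φ (dfall lam y) (suc k)         ≈⟨ ∂-Φ (dfall lam y) k ⟩
      Φ (∂λ (dfall lam y)) k          ≈⟨ Φ-cong (∂λ-dfall y) k ⟩
      Φ (y · dfall lam y) k           ≈⟨ Φ-· y (dfall lam y) k ⟩
      y * Φ (dfall lam y) k           ≈⟨ *-congˡ (Φ-dfall y k) ⟩
      y * y ^ k                       ∎

    ⊛Φ-expansion : ∀ c a n → (c ⊛ Φ a) n ≈
      sumLt (suc n) (λ m → sumLt (suc n ∸ m) (λ j →
        (lam ^ j) * (⟦ S₂ (m ℕ.+ j) m ⟧ * (⟦ n C (m ℕ.+ j) ⟧ * (c (n ∸ (m ℕ.+ j)) * a m)))))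
    ⊛Φ-expansion c a n = begin
      (c ⊛ Φ a) n                                                ≈⟨ ⊛-comm c (Φ a) n ⟩
      (Φ a ⊛ c) n                                                ≈⟨ sum-cong′ (suc n) expand ⟩
      sumLt (suc n) (λ k → sumLt (suc k) (F k))                  ≈⟨ sum-interchange (suc n) F ⟩
      sumLt (suc n) (λ m → sumLt (suc n ∸ m) (λ j → F (m ℕ.+ j) m))
        ≈⟨ sum-cong′ (suc n) (λ m → sum-cong′ (suc n ∸ m) (λ j → *-congʳ (reflexive (P.cong (lam ^_) (ℕₚ.m+n∸m≡n m j))))) ⟩
      _                                                          ∎
      where
      F : ℕ → ℕ → Carrier
      F k m = lam ^ (k ∸ m) * (⟦ S₂ k m ⟧ * (⟦ n C k ⟧ * (c (n ∸ k) * a m)))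
      expand : ∀ k → ⟦ n C k ⟧ * (Φ a k * c (n ∸ k)) ≈ sumLt (suc k) (F k)
      expand k = trans (solve 3 (λ C g e → C :* (g :* e) := (C :* e) :* g) refl _ (Φ a k) _)
        (trans (sym (sum-*ˡ (suc k) _ _)) (sum-cong′ (suc k) (λ m →
          solve 5 (λ C e p s x → (C :* e) :* (p :* (s :* x)) := p :* (s :* (C :* (e :* x)))) refl _ _ _ _ _)))

    T⊛Φ-expansion : ∀ a n → (T ⊛ Φ a) n ≈ n × sumLt n (λ m → (lam ^ (n ∸ m ∸ 1)) * (⟦ S₂ (n ∸ 1) m ⟧ * a m))
    T⊛Φ-expansion a zero    = T⊛-at-0 (Φ a)
    T⊛Φ-expansion a (suc n) = begin
      (T ⊛ Φ a) (suc n) ≈⟨ T⊛-at-suc n (Φ a) ⟩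
      ⟦ suc n ⟧ * Φ a n ≈⟨ *-congˡ (sum-cong′ (suc n) (λ m → *-congʳ (reflexive (P.cong (lam ^_) (P.sym (exponent m)))))) ⟩
      ⟦ suc n ⟧ * row   ≈⟨ sym (×≈⟦⟧* (suc n) row) ⟩
      suc n × row       ∎
      where
      row : Carrier
      row = sumLt (suc n) (λ m → (lam ^ (suc n ∸ m ∸ 1)) * (⟦ S₂ n m ⟧ * a m))
      exponent : ∀ m → suc n ∸ m ∸ 1 ≡ n ∸ m
      exponent m = P.trans (ℕₚ.∸-+-assoc (suc n) m 1) (P.cong (suc n ∸_) (ℕₚ.+-comm m 1))

  module OrderedBell (lam : Carrier) where

    f : Seq
    f = fCoeff lam

    fTable-extends : ∀ n m → m ≤ n → fTable lam (suc n) m ≡ fTable lam n m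
    fTable-extends n m m≤n with m ≤? n
    ... | yes _   = P.refl
    ... | no  m≰n = ⊥-elim (m≰n m≤n)

    f-suc : ∀ n → f (suc n) ≡ sumLt (suc n) (λ j → ⟦ suc n C suc j ⟧ * (dfall lam 1# (suc j) * fTable lam n (n ∸ j)))
    f-suc n with suc n ≤? n
    ... | yes n<n = ⊥-elim (ℕₚ.n≮n n n<n)
    ... | no  _   = P.refl

    bell-recursion : dfall lam 1# ⊛ f ⊕ δ ≋ f ⊕ f
    bell-recursion zero    = +-congʳ (trans (⊛-at-0 (dfall lam 1#) f) (*-identityˡ _))
    bell-recursion (suc n) = begin
      (dfall lam 1# ⊛ f) (suc n) + 0#                 ≈⟨ trans (+-identityʳ _) (sum-first (suc n) _) ⟩
      ⟦ 1 ⟧ * (1# * f (suc n)) + sumLt (suc n) (λ j → ⟦ suc n C suc j ⟧ * (dfall lam 1# (suc j) * f (n ∸ j)))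
        ≈⟨ +-cong (trans (⟦1⟧* _) (*-identityˡ _)) (trans (sum-cong′ (suc n) from-table) (reflexive (P.sym (f-suc n)))) ⟩
      f (suc n) + f (suc n)                           ∎
      where
      from-table : ∀ j → ⟦ suc n C suc j ⟧ * (dfall lam 1# (suc j) * f (n ∸ j))
                         ≈ ⟦ suc n C suc j ⟧ * (dfall lam 1# (suc j) * fTable lam n (n ∸ j))
      from-table j = *-congˡ (*-congˡ (reflexive (P.sym (table-diagonal (fTable lam) fTable-extends n (n ∸ j) (ℕₚ.m∸n≤m n j)))))

  module Bernoulli (hinv : ∀ n → ⟦ suc n ⟧ * inv n ≈ 1#) where

    BTable-extends : ∀ n m → m ≤ n → BTable (suc n) m ≡ BTable n m
    BTable-extends n m m≤n with m ≤? n
    ... | yes _   = P.refl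
    ... | no  m≰n = ⊥-elim (m≰n m≤n)

    Bern-suc : ∀ n → Bern (suc n) ≡ - (inv (suc n) * sumLt (suc n) (λ k → ⟦ suc (suc n) C k ⟧ * BTable n k))
    Bern-suc n with suc n ≤? n
    ... | yes n<n = ⊥-elim (ℕₚ.n≮n n n<n)
    ... | no  _   = P.refl

    bernoulli-recursion : ∀ m → sumLt (suc (suc m)) (λ k → ⟦ suc (suc m) C k ⟧ * Bern k) ≈ 0#
    bernoulli-recursion m = begin
      S + ⟦ suc (suc m) C suc m ⟧ * Bern (suc m)
        ≈⟨ +-congˡ (*-cong (reflexive (P.cong ⟦_⟧ ([1+n]Cn≡1+n (suc m)))) (reflexive (Bern-suc m))) ⟩
      S + ⟦ suc (suc m) ⟧ * - (inv (suc m) * S′)     ≈⟨ +-congˡ (sym (-‿distribʳ-* _ _)) ⟩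
      S + - (⟦ suc (suc m) ⟧ * (inv (suc m) * S′))
        ≈⟨ +-congˡ (-‿cong (trans (sym (*-assoc _ _ _)) (trans (*-congʳ (hinv (suc m))) (*-identityˡ _)))) ⟩
      S + - S′
        ≈⟨ +-congˡ (-‿cong (sum-cong (suc m) (λ k k≤m → *-congˡ (reflexive (from-table k k≤m))))) ⟩
      S + - S                                        ≈⟨ -‿inverseʳ S ⟩
      0#                                             ∎
      where
      S S′ : Carrier
      S  = sumLt (suc m) (λ k → ⟦ suc (suc m) C k ⟧ * Bern k)
      S′ = sumLt (suc m) (λ k → ⟦ suc (suc m) C k ⟧ * BTable m k)
      from-table : ∀ k → k < suc m → BTable m k ≡ Bern k
      from-table k (s≤s k≤m) = table-diagonal BTable BTable-extends m k k≤m

    Bern⊛E : Bern ⊛ E ≋ Bern ⊕ T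
    Bern⊛E zero    = trans (⊛-at-0 Bern E) (trans (*-identityʳ _) (sym (+-identityʳ _)))
    Bern⊛E (suc n) = begin
      sumLt (suc n) term + term (suc n)
        ≈⟨ +-cong (trans (sum-cong′ (suc n) (λ k → *-congˡ (*-identityʳ _))) (lower n))
                  (trans (*-cong (reflexive (P.cong ⟦_⟧ (nCn≡1 (suc n)))) (*-identityʳ _)) (⟦1⟧* _)) ⟩
      δ n + Bern (suc n)                  ≈⟨ +-comm _ _ ⟩
      Bern (suc n) + T (suc n)            ∎
      where
      term : ℕ → Carrier
      term k = ⟦ suc n C k ⟧ * (Bern k * 1#)
      lower : ∀ n → sumLt (suc n) (λ k → ⟦ suc n C k ⟧ * Bern k) ≈ δ n
      lower zero    = trans (+-identityˡ _) (⟦1⟧* _)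
      lower (suc m) = bernoulli-recursion m

module Main {c ℓ : Level} (R : CommutativeRing c ℓ) (inv : ℕ → CommutativeRing.Carrier R)
  (hinv : ∀ n → CommutativeRing._≈_ R (CommutativeRing._*_ R (Q.⟦_⟧ R inv (suc n)) (inv n)) (CommutativeRing.1# R))
  (lam x : CommutativeRing.Carrier R) where
  open Q R inv using (Bern; b; dfall)
  open Sequences R inv
  open Stirling lam
  open OrderedBell lam
  open Bernoulli hinv
  open CommutativeRing R using (1#)
  open CommutativeRing (Pointwise.commutativeRing ℕ R)
    using (setoid; refl; sym; trans; +-cong; +-congˡ; +-assoc; +-comm; +-group)
  open GroupProperties +-group using (x≈z//y; ∙-cancelˡ)
  open SetoidReasoning setoid

  e₁ eₓ bell g : Seq
  e₁ = dfall lam 1#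
  eₓ = dfall lam x
  bell m = b lam m x
  g = Φ bell

  -- e₁ b + eₓ = 2b, from b = f eₓ and e₁ f + 1 = 2f.
  bell-equation : e₁ ⊛ bell ⊕ eₓ ≋ bell ⊕ bell
  bell-equation = begin
    e₁ ⊛ (f ⊛ eₓ) ⊕ eₓ        ≈⟨ +-cong (sym (⊛-assoc e₁ f eₓ)) (sym (⊛-identityˡ eₓ)) ⟩
    (e₁ ⊛ f) ⊛ eₓ ⊕ δ ⊛ eₓ    ≈⟨ sym (⊛-distribʳ (e₁ ⊛ f) δ eₓ) ⟩
    (e₁ ⊛ f ⊕ δ) ⊛ eₓ         ≈⟨ ⊛-congʳ eₓ bell-recursion ⟩
    (f ⊕ f) ⊛ eₓ              ≈⟨ ⊛-distribʳ f f eₓ ⟩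
    bell ⊕ bell               ∎

  -- Applying Φ:  eᵗ g + e^{xt} = 2g.
  power-equation : E ⊛ g ⊕ pow x ≋ g ⊕ g
  power-equation = begin
    E ⊛ g ⊕ pow x             ≈⟨ sym (+-cong (⊛-congʳ g (trans (Φ-dfall 1#) pow-1#)) (Φ-dfall x)) ⟩
    Φ e₁ ⊛ Φ bell ⊕ Φ eₓ      ≈⟨ sym (+-cong (Φ-⊛ e₁ bell) refl) ⟩
    Φ (e₁ ⊛ bell) ⊕ Φ eₓ      ≈⟨ sym (Φ-⊕ (e₁ ⊛ bell) eₓ) ⟩
    Φ (e₁ ⊛ bell ⊕ eₓ)        ≈⟨ Φ-cong bell-equation ⟩
    Φ (bell ⊕ bell)           ≈⟨ Φ-⊕ bell bell ⟩
    g ⊕ g                     ∎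

  -- Multiplying by B and using B eᵗ = B + t:  B e^{xt} = B g − t g.
  bernoulli-equation : Bern ⊛ pow x ≋ Bern ⊛ g ⊖ T ⊛ g
  bernoulli-equation = x≈z//y (Bern ⊛ pow x) (T ⊛ g) (Bern ⊛ g)
    (∙-cancelˡ (Bern ⊛ g) (Bern ⊛ pow x ⊕ T ⊛ g) (Bern ⊛ g) (begin
      Bern ⊛ g ⊕ (Bern ⊛ pow x ⊕ T ⊛ g)  ≈⟨ trans (+-congˡ (+-comm _ _)) (sym (+-assoc _ _ _)) ⟩
      (Bern ⊛ g ⊕ T ⊛ g) ⊕ Bern ⊛ pow x  ≈⟨ +-cong (sym (⊛-distribʳ Bern T g)) refl ⟩
      (Bern ⊕ T) ⊛ g ⊕ Bern ⊛ pow x      ≈⟨ +-cong (⊛-congʳ g (sym Bern⊛E)) refl ⟩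
      (Bern ⊛ E) ⊛ g ⊕ Bern ⊛ pow x      ≈⟨ +-cong (⊛-assoc Bern E g) refl ⟩
      Bern ⊛ (E ⊛ g) ⊕ Bern ⊛ pow x      ≈⟨ sym (⊛-distribˡ Bern (E ⊛ g) (pow x)) ⟩
      Bern ⊛ (E ⊛ g ⊕ pow x)             ≈⟨ ⊛-congˡ Bern power-equation ⟩
      Bern ⊛ (g ⊕ g)                     ≈⟨ ⊛-distribˡ Bern g g ⟩
      Bern ⊛ g ⊕ Bern ⊛ g                ∎))

theorem9 : {c ℓ : Level} (R : CommutativeRing c ℓ) (inv : ℕ → CommutativeRing.Carrier R) →
    (∀ n → CommutativeRing._≈_ R (CommutativeRing._*_ R (Q.⟦_⟧ R inv (suc n)) (inv n)) (CommutativeRing.1# R)) →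
    (lam : CommutativeRing.Carrier R) → ¬ CommutativeRing._≈_ R lam (CommutativeRing.0# R) →
    (n : ℕ) (x : CommutativeRing.Carrier R) →
    CommutativeRing._≈_ R (Q.BernPoly R inv n x) (Q.rhs R inv lam n x)
theorem9 R inv hinv lam _ n x = begin
  Q.BernPoly R inv n x          ≈⟨ bernoulli-equation n ⟩
  (Bern ⊛ g) n - (T ⊛ g) n      ≈⟨ +-cong (⊛Φ-expansion Bern bell n) (-‿cong (T⊛Φ-expansion bell n)) ⟩
  Q.rhs R inv lam n x           ∎
  where
  open CommutativeRing R
  open Q R inv using (Bern)
  open Sequences R inv
  open Stirling lam
  open Main R inv hinv lam x
  open SetoidReasoning setoid
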